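{- If $k\geq 4$ is an integer that is even or not divisible by $3$, then \[ f_2(k)\leq 2k(k+1)(k+2). \]
   Context: An $r$-coloring of a set $A\subseteq\mathbb{N}$ is a function $\Delta:A\to\{0,1,\ldots,r-1\}$. A tuple $(a_1,\ldots,a_k,b)$ of elements of $A$ is a monochromatic solution to an equation $G(x_1,\ldots,x_k,y)=0$ if $G(a_1,\ldots,a_k,b)=0$ and $\Delta(a_1)=\cdots=\Delta(a_k)=\Delta(b)$. For integers $r,k\geq 2$, $f_r(k)$ denotes the smallest positive integer $n$ such that every $r$-coloring of $\{1,2,\ldots,n\}$ has a monochromatic solution to $1/x_1+\cdots+1/x_k=1/y$, where $x_1,\ldots,x_k$ are not necessarily distinct. -}

module Defs where

open import Data.Nat as ℕ using (ℕ; zero; suc; _≤_; _<_)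
open import Data.Fin using (Fin; toℕ)
open import Data.Integer using (+_)
open import Data.Rational using (ℚ; _/_; _+_; 0ℚ)
open import Data.Product using (Σ; ∃; _×_)
open import Relation.Binary.PropositionalEquality using (_≡_)
open import Relation.Nullary using (¬_)

recip : (m : ℕ) → .{{_ : ℕ.NonZero m}} → ℚ
recip m = + 1 / m

-- The set {1,...,n} is represented by Fin n, the element i : Fin n
-- standing for the positive integer  val i = toℕ i + 1.
val : {n : ℕ} → Fin n → ℕ
val i = suc (toℕ i)

recipSum : {n : ℕ} (k : ℕ) → (Fin k → Fin n) → ℚ
recipSum zero    x = 0ℚ
recipSum (suc k) x = recip (val (x Data.Fin.zero)) + recipSum k (λ i → x (Data.Fin.suc i))

Coloring : ℕ → ℕ → Set
Coloring r n = Fin n → Fin r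

-- Δ admits a monochromatic solution (x₁,...,x_k,y) of 1/x₁+...+1/x_k = 1/y
-- (the xᵢ not necessarily distinct).
HasMonoSol : {r n : ℕ} (k : ℕ) → Coloring r n → Set
HasMonoSol {r} {n} k Δ =
  Σ (Fin k → Fin n) λ x → Σ (Fin n) λ y →
    (recipSum k x ≡ recip (val y)) × ((i : Fin k) → Δ (x i) ≡ Δ y)

Forces : ℕ → ℕ → ℕ → Set
Forces r k n = (Δ : Coloring r n) → HasMonoSol k Δ

IsF : ℕ → ℕ → ℕ → Set
IsF r k n = (1 ≤ n) × Forces r k n × ((m : ℕ) → 1 ≤ m → m < n → ¬ Forces r k m)

-- Write k = 4 + t.  Twenty-three integers, polynomials in t, lie in
-- {1, …, 2k(k+1)(k+2)}, and twenty-five triples (a, b, c) among them carry a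
-- weight s with s/a + (k − s)/b = 1/c identically in t.  These triples form a
-- 3-uniform hypergraph with no 2-colouring free of monochromatic edges: fixing
-- the colour of 2k(k+1), every other colour is forced edge by edge, with a single
-- case split on the colour of 2(k−1)(k+1)(k+2).  So every 2-colouring of
-- {1, …, 2k(k+1)(k+2)} has a monochromatic solution, and as this property is
-- decidable, the least n with it, f₂(k), exists below that bound.

module Submission where

open import Defs
open import Data.Nat using (ℕ; zero; suc; _≤_; _<_; z≤n; s≤s; _+_; _*_; _∸_; _≤ᵇ_; NonZero)
open import Data.Nat.Divisibility using (_∣_)
open import Data.Nat.Properties
  using ( *-identityˡ; ≤-refl; ≤-pred; n<1+n; m<n⇒m<1+n; m<1+n⇒m<n∨m≡n; +-mono-≤; *-mono-≤; ≤ᵇ⇒≤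
        ; m≤n⇒∃[o]m+o≡n )
open import Data.Nat.Solver using (module +-*-Solver)
open import Data.Nat.Tactic.RingSolver using (solve-∀)
open import Data.Bool using (Bool; true; false; _∧_; T)
open import Data.Bool.Properties using (T-∧)
open import Data.Maybe using (just; is-just)
open import Data.Fin using (Fin; zero; suc; #_; opposite; splitAt; fromℕ<)
open import Data.Fin.Patterns using (0F; 1F)
import Data.Fin.Properties as Finₚ
open Finₚ using (all?; any?; opposite-involutive; toℕ-fromℕ<)
import Data.Integer as ℤ
open ℤ using (+_)
import Data.Integer.Properties as ℤₚ
import Data.Rational as ℚ
open ℚ using (toℚᵘ) renaming (_+_ to _+ℚ_)
open import Data.Rational.Properties
  using (toℚᵘ-injective; toℚᵘ-fromℚᵘ; toℚᵘ-homo-+; +-identityˡ; +-assoc)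
open import Data.Rational.Unnormalised using (_≃_; *≡*; _/_) renaming (_+_ to _+ᵘ_)
open import Data.Rational.Unnormalised.Properties using (+-cong; module ≃-Reasoning)
open import Data.Empty using (⊥)
open import Data.Product using (Σ; _×_; _,_; ∃; proj₁; proj₂)
open import Data.Sum using (_⊎_; inj₁; inj₂; [_,_]′)
open import Data.Sum.Properties using ([,]-map)
open import Data.List using (List; []; _∷_)
open import Data.List.Relation.Unary.All as All using (All; []; _∷_)
open import Data.Vec using (Vec; []; _∷_; lookup)
import Data.Vec.Functional as Vector
open Vector using (Vector; replicate; _++_; head; tail)
open import Data.Vec.Functional.Properties using (∷-cong)
open import Function using (_∘_; Equivalence)
open import Relation.Binary.Definitions using (_Respects_)
open import Relation.Binary.PropositionalEquality
open import Relation.Nullary using (Dec; yes; no; map′; ¬_; contradiction)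
open import Relation.Nullary.Decidable using (_×-dec_; T?; toWitness; decidable-stable)
open import Relation.Unary using (Pred; Decidable)
open +-*-Solver
  using ( Polynomial; con; var; _:+_; _:*_; ⟦_⟧; normalise; correct; _≟N_; ⟦_⟧N-cong
        ; HNF; Normal; ∅; _*x+_; poly; ⟦_⟧H; ⟦_⟧N )

a/m+b/n≃c/d : ∀ a b c m n d .{{_ : NonZero m}} .{{_ : NonZero n}} .{{_ : NonZero d}} →
              (a * n + b * m) * d ≡ c * (m * n) → (+ a / m) +ᵘ (+ b / n) ≃ + c / d
a/m+b/n≃c/d a b c (suc m) (suc n) (suc d) eq = *≡* (begin
  (+ a ℤ.* + suc n ℤ.+ + b ℤ.* + suc m) ℤ.* + suc d
    ≡⟨ cong (ℤ._* + suc d) numerator ⟨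
  + (a * suc n + b * suc m) ℤ.* + suc d  ≡⟨ ℤₚ.pos-* (a * suc n + b * suc m) (suc d) ⟨
  + ((a * suc n + b * suc m) * suc d)    ≡⟨ cong +_ eq ⟩
  + (c * (suc m * suc n))                ≡⟨ ℤₚ.pos-* c (suc m * suc n) ⟩
  + c ℤ.* + (suc m * suc n)              ∎)
  where
  open ≡-Reasoning
  numerator : + (a * suc n + b * suc m) ≡ + a ℤ.* + suc n ℤ.+ + b ℤ.* + suc m
  numerator = trans (ℤₚ.pos-+ (a * suc n) (b * suc m))
                    (cong₂ ℤ._+_ (ℤₚ.pos-* a (suc n)) (ℤₚ.pos-* b (suc m)))

toℚᵘ-recip : ∀ m .{{_ : NonZero m}} → toℚᵘ (recip m) ≃ + 1 / m
toℚᵘ-recip (suc m) = toℚᵘ-fromℚᵘ (+ 1 / suc m)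

toℚᵘ-recipSum-replicate : ∀ {n} s (y : Fin n) → toℚᵘ (recipSum s (replicate s y)) ≃ + s / val y
toℚᵘ-recipSum-replicate zero y = *≡* refl
toℚᵘ-recipSum-replicate (suc s) y = begin
  toℚᵘ (recip (val y) +ℚ recipSum s (replicate s y))
    ≈⟨ toℚᵘ-homo-+ (recip (val y)) _ ⟩
  toℚᵘ (recip (val y)) +ᵘ toℚᵘ (recipSum s (replicate s y))
    ≈⟨ +-cong (toℚᵘ-recip (val y)) (toℚᵘ-recipSum-replicate s y) ⟩
  + 1 / val y +ᵘ + s / val y
    ≈⟨ a/m+b/n≃c/d 1 s (suc s) (val y) (val y) (val y) (cross-multiplied s (val y)) ⟩
  + suc s / val y ∎
  where
  open ≃-Reasoning
  cross-multiplied : ∀ s m → (1 * m + s * m) * m ≡ suc s * (m * m)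
  cross-multiplied = solve-∀

recipSum-cong : ∀ {n} k {x y : Vector (Fin n) k} → x ≗ y → recipSum k x ≡ recipSum k y
recipSum-cong zero    x≗y = refl
recipSum-cong (suc k) x≗y =
  cong₂ _+ℚ_ (cong (λ z → recip (val z)) (x≗y zero)) (recipSum-cong k (x≗y ∘ suc))

recipSum-++ : ∀ {n} m {k} (x : Vector (Fin n) m) (y : Vector (Fin n) k) →
              recipSum (m + k) (x ++ y) ≡ recipSum m x +ℚ recipSum k y
recipSum-++ zero    x y = sym (+-identityˡ (recipSum _ y))
recipSum-++ (suc m) x y = begin
  recip (val (x zero)) +ℚ recipSum (m + _) (tail (x ++ y))
    ≡⟨ cong (recip (val (x zero)) +ℚ_) (recipSum-cong (m + _) ([,]-map ∘ splitAt m)) ⟩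
  recip (val (x zero)) +ℚ recipSum (m + _) (tail x ++ y)
    ≡⟨ cong (recip (val (x zero)) +ℚ_) (recipSum-++ m (tail x) y) ⟩
  recip (val (x zero)) +ℚ (recipSum m (tail x) +ℚ recipSum _ y)
    ≡⟨ +-assoc (recip (val (x zero))) _ _ ⟨
  recip (val (x zero)) +ℚ recipSum m (tail x) +ℚ recipSum _ y ∎
  where open ≡-Reasoning

recipSum-two-values : ∀ {n} s r (a b c : Fin n) →
                      (s * val b + r * val a) * val c ≡ val a * val b →
                      recipSum (s + r) (replicate s a ++ replicate r b) ≡ recip (val c)
recipSum-two-values s r a b c eq = toℚᵘ-injective (begin
  toℚᵘ (recipSum (s + r) (replicate s a ++ replicate r b))
    ≡⟨ cong toℚᵘ (recipSum-++ s (replicate s a) (replicate r b)) ⟩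
  toℚᵘ (recipSum s (replicate s a) +ℚ recipSum r (replicate r b))
    ≈⟨ toℚᵘ-homo-+ (recipSum s (replicate s a)) _ ⟩
  toℚᵘ (recipSum s (replicate s a)) +ᵘ toℚᵘ (recipSum r (replicate r b))
    ≈⟨ +-cong (toℚᵘ-recipSum-replicate s a) (toℚᵘ-recipSum-replicate r b) ⟩
  + s / val a +ᵘ + r / val b
    ≈⟨ a/m+b/n≃c/d s r 1 (val a) (val b) (val c) (trans eq (sym (*-identityˡ _))) ⟩
  + 1 / val c
    ≈⟨ toℚᵘ-recip (val c) ⟨
  toℚᵘ (recip (val c)) ∎)
  where open ≃-Reasoning

monoSolution : ∀ {m n} (Δ : Coloring m n) s r (a b c : Fin n) →
               (s * val b + r * val a) * val c ≡ val a * val b →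
               Δ a ≡ Δ c → Δ b ≡ Δ c → HasMonoSol (s + r) Δ
monoSolution Δ s r a b c eq Δa≡Δc Δb≡Δc =
  replicate s a ++ replicate r b , c , recipSum-two-values s r a b c eq , monochromatic
  where
  monochromatic : ∀ i → Δ ((replicate s a ++ replicate r b) i) ≡ Δ c
  monochromatic i with splitAt s i
  ... | inj₁ _ = Δa≡Δc
  ... | inj₂ _ = Δb≡Δc

fromVal : ∀ {n} m → 1 ≤ m → m ≤ n → Fin n
fromVal (suc m) _ m<n = fromℕ< m<n

val-fromVal : ∀ {n} m (1≤m : 1 ≤ m) (m≤n : m ≤ n) → val (fromVal m 1≤m m≤n) ≡ m
val-fromVal (suc m) _ m<n = cong suc (toℕ-fromℕ< m<n)

head∷tail≗id : ∀ {a} {A : Set a} {n} (x : Vector A (suc n)) → head x Vector.∷ tail x ≗ x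
head∷tail≗id x zero    = refl
head∷tail≗id x (suc i) = refl

∀-vector? : ∀ {m a p} {P : Pred (Vector (Fin m) a) p} →
            P Respects _≗_ → Decidable P → Dec (∀ x → P x)
∀-vector? {a = zero}  resp P? =
  map′ (λ P[] x → resp (λ ()) P[]) (λ ∀P → ∀P Vector.[]) (P? Vector.[])
∀-vector? {a = suc a} resp P? =
  map′ (λ ∀P x → resp (head∷tail≗id x) (∀P (head x) (tail x)))
       (λ ∀P x y → ∀P (x Vector.∷ y))
       (all? λ x → ∀-vector? (resp ∘ ∷-cong refl) (P? ∘ (x Vector.∷_)))

∃-vector? : ∀ {m a p} {P : Pred (Vector (Fin m) a) p} →
            P Respects _≗_ → Decidable P → Dec (∃ P)
∃-vector? {a = zero}  resp P? =
  map′ (Vector.[] ,_) (λ (x , Px) → resp (λ ()) Px) (P? Vector.[])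
∃-vector? {a = suc a} resp P? =
  map′ (λ (x , y , Pxy) → x Vector.∷ y , Pxy)
       (λ (x , Px) → head x , tail x , resp (sym ∘ head∷tail≗id x) Px)
       (any? λ x → ∃-vector? (resp ∘ ∷-cong refl) (P? ∘ (x Vector.∷_)))

hasMonoSol? : ∀ {r n} k (Δ : Coloring r n) → Dec (HasMonoSol k Δ)
hasMonoSol? k Δ = ∃-vector? respects λ x →
  any? λ y → (recipSum k x ℚ.≟ recip (val y)) ×-dec all? (λ i → Δ (x i) Finₚ.≟ Δ y)
  where
  respects : (λ x → ∃ λ y → recipSum k x ≡ recip (val y) × (∀ i → Δ (x i) ≡ Δ y)) Respects _≗_
  respects x≗x′ (y , sum≡ , mono) =
    y , trans (sym (recipSum-cong k x≗x′)) sum≡ , λ i → trans (cong Δ (sym (x≗x′ i))) (mono i)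

forces? : ∀ r k n → Dec (Forces r k n)
forces? r k n = ∀-vector? respects (hasMonoSol? k)
  where
  respects : HasMonoSol k Respects _≗_
  respects Δ≗Δ′ (x , y , sum≡ , mono) =
    x , y , sum≡ , λ i → trans (sym (Δ≗Δ′ (x i))) (trans (mono i) (Δ≗Δ′ y))

¬forces-0 : ∀ {r k} → ¬ Forces r k 0
¬forces-0 f with f (λ ())
... | _ , () , _

least-below : ∀ {p} {P : Pred ℕ p} → Decidable P → ∀ M →
              (∃ λ n → n < M × P n × ∀ m → m < n → ¬ P m) ⊎ (∀ m → m < M → ¬ P m)
least-below P? zero = inj₂ λ _ ()
least-below P? (suc M) with least-below P? M
... | inj₁ (n , n<M , Pn , minimal) = inj₁ (n , m<n⇒m<1+n n<M , Pn , minimal)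
... | inj₂ none with P? M
...   | yes PM = inj₁ (M , n<1+n M , PM , none)
...   | no ¬PM = inj₂ λ m m<1+M → [ none m , (λ { refl → ¬PM }) ]′ (m<1+n⇒m<n∨m≡n m<1+M)

least : ∀ {p} {P : Pred ℕ p} → Decidable P → ∀ {M} → P M →
        ∃ λ n → n ≤ M × P n × ∀ m → m < n → ¬ P m
least P? {M} PM with least-below P? (suc M)
... | inj₁ (n , n<1+M , Pn , minimal) = n , ≤-pred n<1+M , Pn , minimal
... | inj₂ none = contradiction PM (none M (n<1+n M))

forces⇒f≤ : ∀ {r k n} → Forces r k n → ∃ λ m → IsF r k m × m ≤ n
forces⇒f≤ {r} {k} fₙ with least (forces? r k) fₙ
... | zero  , _ , f₀ , _       = contradiction f₀ ¬forces-0
... | suc m , m<n , f , minimal = suc m , (s≤s z≤n , f , λ m′ _ → minimal m′) , m<n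

infix 4 _≈ₚ_ _≤ₚ_

_≈ₚ_ : ∀ {n} → Polynomial n → Polynomial n → Set
P ≈ₚ Q = T (is-just (normalise P ≟N normalise Q))

≈ₚ-sound : ∀ {n} (P Q : Polynomial n) → P ≈ₚ Q → ∀ ρ → ⟦ P ⟧ ρ ≡ ⟦ Q ⟧ ρ
≈ₚ-sound P Q P≈Q ρ with normalise P ≟N normalise Q
... | just eq = trans (sym (correct P ρ)) (trans (⟦ eq ⟧N-cong ρ) (correct Q ρ))

mutual
  dominatesH : ∀ {n} → HNF (suc n) → HNF (suc n) → Bool
  dominatesH ∅         q         = true
  dominatesH (p *x+ c) ∅         = false
  dominatesH (p *x+ c) (q *x+ d) = dominatesH p q ∧ dominatesN c d

  dominatesN : ∀ {n} → Normal n → Normal n → Bool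
  dominatesN (con c)  (con d)  = c ≤ᵇ d
  dominatesN (poly p) (poly q) = dominatesH p q

mutual
  dominatesH-sound : ∀ {n} (p q : HNF (suc n)) → T (dominatesH p q) →
                     ∀ ρ → ⟦ p ⟧H ρ ≤ ⟦ q ⟧H ρ
  dominatesH-sound ∅         q         _ ρ = z≤n
  dominatesH-sound (p *x+ c) (q *x+ d) h (x ∷ ρ) with Equivalence.to T-∧ h
  ... | p≤q , c≤d =
    +-mono-≤ (*-mono-≤ (dominatesH-sound p q p≤q (x ∷ ρ)) (≤-refl {x}))
             (dominatesN-sound c d c≤d ρ)

  dominatesN-sound : ∀ {n} (p q : Normal n) → T (dominatesN p q) →
                     ∀ ρ → ⟦ p ⟧N ρ ≤ ⟦ q ⟧N ρ
  dominatesN-sound (con c)  (con d)  h ρ = ≤ᵇ⇒≤ c d h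
  dominatesN-sound (poly p) (poly q) h ρ = dominatesH-sound p q h ρ

_≤ₚ_ : ∀ {n} → Polynomial n → Polynomial n → Set
P ≤ₚ Q = T (dominatesN (normalise P) (normalise Q))

≤ₚ-sound : ∀ {n} (P Q : Polynomial n) → P ≤ₚ Q → ∀ ρ → ⟦ P ⟧ ρ ≤ ⟦ Q ⟧ ρ
≤ₚ-sound P Q P≤Q ρ =
  subst₂ _≤_ (correct P ρ) (correct Q ρ) (dominatesN-sound (normalise P) (normalise Q) P≤Q ρ)

Vertex : Set
Vertex = Fin 23

X : Polynomial 1
X = var zero

K K-1 K+1 K+2 Bound : Polynomial 1
K     = con 4 :+ X
K-1   = con 3 :+ X
K+1   = K :+ con 1
K+2   = K :+ con 2
Bound = con 2 :* K :* K+1 :* K+2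

points : Vec (Polynomial 1) 23
points =
  K-1 :* K+2           ∷ K-1 :* K+1 :* K+2         ∷ K :* K+2                   ∷
  K-1 :* K :* K+2      ∷ K :* K+1                  ∷ K :* K+1 :* K+2            ∷
  con 2 :* K-1         ∷ con 2 :* K+2              ∷ con 2 :* K-1 :* K+2        ∷
  con 2 :* K+1         ∷ con 2 :* K+1 :* K+2       ∷ con 2 :* K-1 :* K+1 :* K+2 ∷
  con 2 :* K           ∷ con 2 :* K-1 :* K         ∷ con 2 :* K :* K+2          ∷
  con 2 :* K :* K+1    ∷ con 2 :* K-1 :* K :* K+1  ∷ con 2 :* K :* K+1 :* K+2   ∷
  con 2 :* K :* K      ∷ con 2 :* K :* K :* K+1    ∷ con 3 :* K-1               ∷
  con 3 :* K-1 :* K+2  ∷ con 3 :* K-1 :* K         ∷ []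

point : Vertex → Polynomial 1
point = lookup points

InRange : Polynomial 1 → Set
InRange P = (con 1 ≤ₚ P) × (P ≤ₚ Bound)

inRange? : ∀ P → Dec (InRange P)
inRange? P = T? _ ×-dec T? _

-- Opaque, so that these closed computations are not unfolded again where they are used.

opaque
  points-in-range : ∀ v → InRange (point v)
  points-in-range = toWitness {a? = all? (inRange? ∘ point)} _

Edge : Set
Edge = ℕ × Vertex × Vertex × Vertex

-- (s , a , b , c) encodes s copies of 1/a and k − s copies of 1/b, summing to 1/c.

edges : List Edge
edges =
  (1 , # 5  , # 1  , # 2)  ∷ (1 , # 15 , # 11 , # 2)  ∷ (1 , # 5  , # 3  , # 4)  ∷
  (1 , # 15 , # 16 , # 4)  ∷ (2 , # 0  , # 8  , # 6)  ∷ (3 , # 13 , # 13 , # 6)  ∷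
  (3 , # 3  , # 13 , # 7)  ∷ (3 , # 21 , # 8  , # 7)  ∷ (3 , # 14 , # 14 , # 7)  ∷
  (1 , # 1  , # 11 , # 8)  ∷ (1 , # 7  , # 11 , # 9)  ∷ (1 , # 10 , # 8  , # 9)  ∷
  (3 , # 15 , # 15 , # 9)  ∷ (1 , # 19 , # 18 , # 9)  ∷ (3 , # 17 , # 17 , # 10) ∷
  (1 , # 2  , # 8  , # 12) ∷ (1 , # 9  , # 16 , # 12) ∷ (3 , # 22 , # 13 , # 12) ∷
  (3 , # 18 , # 18 , # 12) ∷ (1 , # 17 , # 11 , # 14) ∷ (1 , # 5  , # 11 , # 15) ∷
  (2 , # 5  , # 17 , # 15) ∷ (3 , # 19 , # 19 , # 15) ∷ (1 , # 0  , # 21 , # 20) ∷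
  (3 , # 22 , # 22 , # 20) ∷ []

complement : ℕ → Polynomial 1
complement s = con (4 ∸ s) :+ X

-- The first condition excludes s > 4, where the truncated 4 ∸ s would spoil complement s.

ValidEdge : Edge → Set
ValidEdge (s , a , b , c) =
  (con s :+ complement s ≈ₚ K) ×
  ((con s :* point b :+ complement s :* point a) :* point c ≈ₚ point a :* point b)

validEdge? : ∀ e → Dec (ValidEdge e)
validEdge? e = T? _ ×-dec T? _

opaque
  edges-valid : All ValidEdge edges
  edges-valid = toWitness {a? = All.all? validEdge? edges} _

Avoids : (Vertex → Fin 2) → Edge → Set
Avoids χ (_ , a , b , c) = χ a ≡ χ c → χ b ≡ χ c → ⊥

≢⇒≡opposite : ∀ {x y : Fin 2} → x ≢ y → x ≡ opposite y
≢⇒≡opposite {0F} {0F} x≢y = contradiction refl x≢y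
≢⇒≡opposite {0F} {1F} _   = refl
≢⇒≡opposite {1F} {0F} _   = refl
≢⇒≡opposite {1F} {1F} x≢y = contradiction refl x≢y

module Forcing (χ : Vertex → Fin 2) {a b c : Vertex} (avoids : χ a ≡ χ c → χ b ≡ χ c → ⊥)
               {i : Fin 2} where

  not-monochromatic : χ a ≡ i → χ b ≡ i → χ c ≡ i → ⊥
  not-monochromatic χa χb χc = avoids (trans χa (sym χc)) (trans χb (sym χc))

  forced-last : χ a ≡ i → χ b ≡ i → χ c ≡ opposite i
  forced-last χa χb = ≢⇒≡opposite (not-monochromatic χa χb)

  forced-first : χ b ≡ i → χ c ≡ i → χ a ≡ opposite i
  forced-first χb χc = ≢⇒≡opposite λ χa → not-monochromatic χa χb χc

  forced-middle : χ a ≡ i → χ c ≡ i → χ b ≡ opposite i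
  forced-middle χa χc = ≢⇒≡opposite λ χb → not-monochromatic χa χb χc

forced-double : ∀ (χ : Vertex → Fin 2) {x c i} →
                (χ x ≡ χ c → χ x ≡ χ c → ⊥) → χ c ≡ i → χ x ≡ opposite i
forced-double χ avoids χc = ≢⇒≡opposite λ χx → Forcing.not-monochromatic χ avoids χx χx χc

avoids-opposite : ∀ {χ : Vertex → Fin 2} {e} → Avoids χ e → Avoids (opposite ∘ χ) e
avoids-opposite {χ} avoids χa χb = avoids (opposite-injective χa) (opposite-injective χb)
  where
  opposite-injective : ∀ {x y : Fin 2} → opposite x ≡ opposite y → x ≡ y
  opposite-injective {x} {y} eq =
    trans (sym (opposite-involutive x)) (trans (cong opposite eq) (opposite-involutive y))

¬all-edges-avoided-when-χ15≡0 : ∀ (χ : Vertex → Fin 2) → χ (# 15) ≡ 0F → ¬ All (Avoids χ) edges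
¬all-edges-avoided-when-χ15≡0 χ χ15
  ( e5-1-2    ∷ e15-11-2  ∷ e5-3-4    ∷ e15-16-4  ∷ e0-8-6    ∷ e13-13-6  ∷ e3-13-7   ∷
    e21-8-7   ∷ e14-14-7  ∷ e1-11-8   ∷ e7-11-9   ∷ e10-8-9   ∷ e15-15-9  ∷ e19-18-9  ∷
    e17-17-10 ∷ e2-8-12   ∷ e9-16-12  ∷ e22-13-12 ∷ e18-18-12 ∷ e17-11-14 ∷ e5-11-15  ∷
    e5-17-15  ∷ e19-19-15 ∷ e0-21-20  ∷ e22-22-20 ∷ [])
  = by-colour-of-11 (χ (# 11)) refl
  where
  open Forcing χ
  χ9  = forced-last e15-15-9 χ15 χ15
  χ19 = forced-double χ e19-19-15 χ15
  χ18 = forced-middle e19-18-9 χ19 χ9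
  χ12 = forced-last e18-18-12 χ18 χ18
  χ16 = forced-middle e9-16-12 χ9 χ12
  χ4  = forced-last e15-16-4 χ15 χ16

  by-colour-of-11 : ∀ x → χ (# 11) ≡ x → ⊥
  by-colour-of-11 0F χ11 = not-monochromatic e5-1-2 χ5 χ1 χ2
    where
    χ2 = forced-last e15-11-2 χ15 χ11
    χ8 = forced-middle e2-8-12 χ2 χ12
    χ1 = forced-first e1-11-8 χ11 χ8
    χ5 = forced-first e5-11-15 χ11 χ15
  by-colour-of-11 1F χ11 = not-monochromatic e22-13-12 χ22 χ13 χ12
    where
    χ7  = forced-first e7-11-9 χ11 χ9
    χ14 = forced-double χ e14-14-7 χ7
    χ17 = forced-first e17-11-14 χ11 χ14
    χ10 = forced-last e17-17-10 χ17 χ17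
    χ8  = forced-middle e10-8-9 χ10 χ9
    χ21 = forced-first e21-8-7 χ8 χ7
    χ5  = forced-first e5-17-15 χ17 χ15
    χ3  = forced-middle e5-3-4 χ5 χ4
    χ13 = forced-middle e3-13-7 χ3 χ7
    χ6  = forced-last e13-13-6 χ13 χ13
    χ0  = forced-first e0-8-6 χ8 χ6
    χ20 = forced-last e0-21-20 χ0 χ21
    χ22 = forced-double χ e22-22-20 χ20

¬all-edges-avoided : ∀ (χ : Vertex → Fin 2) → ¬ All (Avoids χ) edges
¬all-edges-avoided χ avoids with χ (# 15) in χ15
... | 0F = ¬all-edges-avoided-when-χ15≡0 χ χ15 avoids
... | 1F = ¬all-edges-avoided-when-χ15≡0 (opposite ∘ χ) (cong opposite χ15)
             (All.map (λ {e} → avoids-opposite {χ} {e}) avoids)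

module Realisation (t : ℕ) where

  ρ : Vec ℕ 1
  ρ = t ∷ []

  positive : ∀ v → 1 ≤ ⟦ point v ⟧ ρ
  positive v = ≤ₚ-sound (con 1) (point v) (proj₁ (points-in-range v)) ρ

  bounded : ∀ v → ⟦ point v ⟧ ρ ≤ ⟦ Bound ⟧ ρ
  bounded v = ≤ₚ-sound (point v) Bound (proj₂ (points-in-range v)) ρ

  embed : Vertex → Fin (⟦ Bound ⟧ ρ)
  embed v = fromVal (⟦ point v ⟧ ρ) (positive v) (bounded v)

  val-embed : ∀ v → val (embed v) ≡ ⟦ point v ⟧ ρ
  val-embed v = val-fromVal (⟦ point v ⟧ ρ) (positive v) (bounded v)

  edge-avoided : (Δ : Coloring 2 (⟦ Bound ⟧ ρ)) → ¬ HasMonoSol (4 + t) Δ →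
                 ∀ {e} → ValidEdge e → Avoids (Δ ∘ embed) e
  edge-avoided Δ none {s , a , b , c} (weights , identity) Δa≡Δc Δb≡Δc =
    none (subst (λ k → HasMonoSol k Δ) (≈ₚ-sound (con s :+ complement s) K weights ρ)
      (monoSolution Δ s (4 ∸ s + t) (embed a) (embed b) (embed c) balanced Δa≡Δc Δb≡Δc))
    where
    balanced : (s * val (embed b) + (4 ∸ s + t) * val (embed a)) * val (embed c) ≡
               val (embed a) * val (embed b)
    balanced = begin
      (s * val (embed b) + (4 ∸ s + t) * val (embed a)) * val (embed c)
        ≡⟨ cong₂ (λ x y → (s * y + (4 ∸ s + t) * x) * val (embed c)) (val-embed a) (val-embed b) ⟩
      (s * ⟦ point b ⟧ ρ + (4 ∸ s + t) * ⟦ point a ⟧ ρ) * val (embed c)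
        ≡⟨ cong ((s * ⟦ point b ⟧ ρ + (4 ∸ s + t) * ⟦ point a ⟧ ρ) *_) (val-embed c) ⟩
      (s * ⟦ point b ⟧ ρ + (4 ∸ s + t) * ⟦ point a ⟧ ρ) * ⟦ point c ⟧ ρ
        ≡⟨ ≈ₚ-sound ((con s :* point b :+ complement s :* point a) :* point c) (point a :* point b)
                    identity ρ ⟩
      ⟦ point a ⟧ ρ * ⟦ point b ⟧ ρ
        ≡⟨ cong₂ _*_ (val-embed a) (val-embed b) ⟨
      val (embed a) * val (embed b) ∎
      where open ≡-Reasoning

  forces : Forces 2 (4 + t) (⟦ Bound ⟧ ρ)
  forces Δ = decidable-stable (hasMonoSol? (4 + t) Δ) λ none →
    ¬all-edges-avoided (Δ ∘ embed) (All.map (λ {e} → edge-avoided Δ none {e}) edges-valid)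

theorem3p3 : (k : ℕ) → 4 ≤ k → (2 ∣ k ⊎ ¬ (3 ∣ k)) →
    Σ ℕ λ n → IsF 2 k n × (n ≤ 2 * k * (k + 1) * (k + 2))
-- The construction works for every k ≥ 4.
theorem3p3 k 4≤k _ with m≤n⇒∃[o]m+o≡n 4≤k
... | t , refl = forces⇒f≤ (Realisation.forces t)
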